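{- Let $M\ge 6$ be an integer, let $e_1,e_2,\dots$ be an insertion-only stream of distinct undirected edges (order fixed independently of the sampling randomness), and let the edge sample $\mathcal{S}$ be maintained by reservoir sampling with parameter $M$ (at time $t\le M$ insert $e_t$; at time $t>M$, with probability $M/t$ remove an edge chosen uniformly at random from $\mathcal{S}$ and insert $e_t$, otherwise leave $\mathcal{S}$ unchanged). Let $\lambda=\{\ell_1,\ell_2,\ell_3\}$ and $\gamma=\{g_1,g_2,g_3\}$ be two disjoint triangles (sharing no edge) of the graph formed by the stream, with edges numbered in order of appearance on the stream, and assume that the last edge $\ell_3$ of $\lambda$ appears on the stream before the last edge $g_3$ of $\gamma$. Then \[ \Pr(D_\gamma\mid D_\lambda)\le\Pr(D_\gamma). \]
   Context: A triangle is a set of three edges $\{(u,v),(v,w),(w,u)\}$ with $u,v,w$ distinct. For a triangle $\lambda=\{\ell_1,\ell_2,\ell_3\}$ with edges numbered in order of appearance on the stream, $t_\lambda$ denotes the time step at which $\ell_3$ appears, and $D_\lambda$ is the event that $\ell_1$ and $\ell_2$ are both in $\mathcal{S}$ at the end of time step $t_\lambda-1$. -}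

module Defs where

open import Data.Nat using (ℕ; zero; suc; _+_; _*_; _∸_; _≤_; _<_; _≤ᵇ_; _<ᵇ_; _≡ᵇ_; pred)
open import Data.Bool using (Bool; true; false; if_then_else_; _∧_)
open import Data.Maybe using (Maybe; just; nothing)
open import Data.Fin using (Fin; toℕ)
open import Data.Product using (_×_; _,_; ∃; ∃-syntax)
open import Data.Sum using (_⊎_)
open import Data.Unit using (⊤; tt)
open import Data.List using (List; []; _∷_; map; concatMap; filter; length; upTo; allFin)
open import Data.Bool.ListAction using (any)
open import Data.Integer using (+_)
open import Data.Rational.Unnormalised using (ℚᵘ; mkℚᵘ; 0ℚᵘ)
open import Relation.Binary.PropositionalEquality using (_≡_; _≢_)
open import Relation.Nullary.Decidable using (⌊_⌋)
open import Data.Bool.Properties using (T?)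
open import Data.Bool using (T)

Edge : Set
Edge = ℕ × ℕ

SameEdge : Edge → Edge → Set
SameEdge (a , b) (c , d) = (a ≡ c × b ≡ d) ⊎ (a ≡ d × b ≡ c)

-- A stream e₁ , e₂ , … : the edge arriving at time t ≥ 1 is  e t.
Stream : Set
Stream = ℕ → Edge

ValidStream : Stream → Set
ValidStream e =
  (∀ t → 1 ≤ t → Data.Product.proj₁ (e t) ≢ Data.Product.proj₂ (e t)) ×
  (∀ s t → 1 ≤ s → 1 ≤ t → SameEdge (e s) (e t) → s ≡ t)

EdgeOfTri : Edge → ℕ → ℕ → ℕ → Set
EdgeOfTri x u v w = SameEdge x (u , v) ⊎ SameEdge x (v , w) ⊎ SameEdge x (w , u)

-- A triangle of the stream graph, given by the arrival times t₁ < t₂ < t₃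
-- of its edges ℓ₁, ℓ₂, ℓ₃ (numbered in order of appearance).
-- Since streamed edges are pairwise distinct, {e t₁, e t₂, e t₃} is a
-- 3-element set contained in {(u,v),(v,w),(w,u)}, hence equal to it.
record Triangle (e : Stream) : Set where
  constructor tri
  field
    t₁ t₂ t₃ : ℕ
    1≤t₁ : 1 ≤ t₁
    t₁<t₂ : t₁ < t₂
    t₂<t₃ : t₂ < t₃
    u v w : ℕ
    u≢v : u ≢ v
    v≢w : v ≢ w
    w≢u : w ≢ u
    ℓ₁∈ : EdgeOfTri (e t₁) u v w
    ℓ₂∈ : EdgeOfTri (e t₂) u v w
    ℓ₃∈ : EdgeOfTri (e t₃) u v w
open Triangle public

-- two triangles share no edge (edges are identified with arrival times,
-- which is faithful since streamed edges are distinct)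
EdgeDisjoint : {e : Stream} → Triangle e → Triangle e → Set
EdgeDisjoint λ' γ =
  (t₁ λ' ≢ t₁ γ) × (t₁ λ' ≢ t₂ γ) × (t₁ λ' ≢ t₃ γ) ×
  (t₂ λ' ≢ t₁ γ) × (t₂ λ' ≢ t₂ γ) × (t₂ λ' ≢ t₃ γ) ×
  (t₃ λ' ≢ t₁ γ) × (t₃ λ' ≢ t₂ γ) × (t₃ λ' ≢ t₃ γ)

-- Randomness at time t:  for t ≤ M there is no choice (Fin 1);
-- for t > M a uniform r ∈ Fin t: if r < M (probability M/t) the edge in
-- slot r (a uniformly random edge of S, |S| = M) is replaced by e_t,
-- otherwise (probability 1 - M/t) S is unchanged.

choiceSize : ℕ → ℕ → ℕ
choiceSize M t = if t ≤ᵇ M then 1 else t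

Choices : ℕ → ℕ → Set
Choices M zero    = ⊤
Choices M (suc n) = Choices M n × Fin (choiceSize M (suc n))

-- all outcomes (the uniform probability space for the first n steps)
allChoices : (M n : ℕ) → List (Choices M n)
allChoices M zero    = tt ∷ []
allChoices M (suc n) =
  concatMap (λ c → map (λ r → (c , r)) (allFin (choiceSize M (suc n))))
            (allChoices M n)

-- Sample: M slots (slot j < M); a slot holds the arrival time of its edge.
Slots : Set
Slots = ℕ → Maybe ℕ

setSlot : ℕ → ℕ → Slots → Slots
setSlot j t s = λ i → if i ≡ᵇ j then just t else s i

step : (M t : ℕ) → Fin (choiceSize M t) → Slots → Slots
step M t r s =
  if t ≤ᵇ M then setSlot (t ∸ 1) t s
  else (if toℕ r <ᵇ M then setSlot (toℕ r) t s else s)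

-- content of the sample at the end of time step min(t , n)
sampleAt : (M n : ℕ) → Choices M n → ℕ → Slots
sampleAt M zero    _       t = λ _ → nothing
sampleAt M (suc n) (c , r) t =
  if suc n ≤ᵇ t then step M (suc n) r (sampleAt M n c t) else sampleAt M n c t

eqMaybe : Maybe ℕ → ℕ → Bool
eqMaybe (just x) y = x ≡ᵇ y
eqMaybe nothing  y = false

inSample : (M n : ℕ) → Choices M n → (t s : ℕ) → Bool
inSample M n ω t s = any (λ j → eqMaybe (sampleAt M n ω t j) s) (upTo M)

-- D_λ : ℓ₁ and ℓ₂ are both in S at the end of time step t_λ - 1
D : (M n : ℕ) {e : Stream} → Triangle e → Choices M n → Bool
D M n λ' ω = inSample M n ω (t₃ λ' ∸ 1) (t₁ λ') ∧ inSample M n ω (t₃ λ' ∸ 1) (t₂ λ')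

count : (M n : ℕ) → (Choices M n → Bool) → ℕ
count M n A = length (filter (λ ω → T? (A ω)) (allChoices M n))

-- Pr(A) = count A / |Ω|   (|Ω| ≥ 1, so the denominator |Ω| = pred |Ω| + 1)
Pr : (M n : ℕ) → (Choices M n → Bool) → ℚᵘ
Pr M n A = mkℚᵘ (+ count M n A) (pred (length (allChoices M n)))

-- Pr(A | B) = Pr(A ∩ B) / Pr(B) = count (A ∧ B) / count B
-- (convention 0 if Pr(B) = 0; never used, since Pr(D_λ) > 0 here)
PrCond : (M n : ℕ) → (Choices M n → Bool) → (Choices M n → Bool) → ℚᵘ
PrCond M n A B with count M n B
... | zero  = 0ℚᵘ
... | suc k = mkℚᵘ (+ count M n (λ ω → A ω ∧ B ω)) k

module Submission where

-- All probabilities are counts on the uniform space Ω_n of outcomes of the first n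
-- steps.  With a = t_λ − 1 and b = t_γ − 1, D_λ says that the two earlier edges Y of λ
-- are in the sample S_a, and D_γ that the two earlier edges X of γ are in S_b.
--  * One-step law (`joint-step`, `joint-idle`): given the state after step n, the number
--    of choices at step n+1 keeping a set Z of times stored depends only on n and Z.
--    Hence every step after a multiplies the counts of "Y ⊆ S_a and X ⊆ S_b" by a
--    factor independent of Y (`later-steps`).
--  * Inclusion law (`inclusion`): Pr(Z ⊆ S_a) = 1 if a ≤ M and (M)_k / (a)_k if M ≤ a,
--    where k = |Z|.  A falling-factorial inequality (`fall-negcorr`) then makes the
--    inclusion events of disjoint sets at one time negatively correlated
--    (`inclusion-negcorr`).
--  * Together they give the count inequality `negative-correlation` for Y ⊆ S_a and
--    X ⊆ S_b, which is the lemma after clearing denominators (`conditional-≤`).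

open import Defs
open import Data.Nat using (ℕ; zero; suc; _+_; _*_; _∸_; _≤_; _<_; _≤ᵇ_; _<ᵇ_; _≡ᵇ_; pred; z≤n; s≤s; _≤?_; _<?_; _≟_; >-nonZero)
open import Data.Nat.Properties
open import Data.Nat.Solver using (module +-*-Solver)
open +-*-Solver using (solve; _:=_; _:*_)
open import Data.Bool using (Bool; true; false; if_then_else_; _∧_; _∨_; not; T)
open import Data.Bool.Properties using (T?; ∧-zeroʳ; ∧-identityʳ; ∧-assoc; ∧-comm; ∧-commutativeMonoid)
open import Algebra.Bundles using (CommutativeMonoid)
open import Algebra.Properties.CommutativeSemigroup (CommutativeMonoid.commutativeSemigroup ∧-commutativeMonoid)
  using () renaming (interchange to ∧-interchange; x∙yz≈y∙xz to ∧-leftComm)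
open import Data.Bool.ListAction using (any; or)
open import Data.Maybe using (just; nothing)
open import Data.Maybe.Properties using (just-injective)
open import Data.List using (List; []; _∷_; _++_; map; concatMap; filter; length; upTo; allFin; tabulate)
open import Data.List.Properties using (length-++; length-tabulate; length-filter; ++-identityʳ; filter-++; filter-all; filter-none; filter-accept; filter-reject; map-cong-local)
open import Data.List.Relation.Unary.All as All using (All; []; _∷_)
open import Data.List.Relation.Unary.Unique.Propositional using (Unique)
open import Data.List.Relation.Unary.AllPairs using ([]; _∷_)
open import Data.List.Relation.Unary.AllPairs.Properties using () renaming (++⁺ to unique-++⁺)
open import Data.List.Membership.Propositional using (find; lose)
open import Data.List.Membership.Propositional.Properties using (∈-upTo⁺; ∈-upTo⁻)
open import Data.List.Relation.Unary.Any.Properties using (any⁺; any⁻)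
open import Data.List.Relation.Unary.All.Properties using (applyUpTo⁺₁; all-filter) renaming (filter⁺ to all-filter⁺; ++⁺ to all-++⁺)
open import Data.List.Relation.Unary.Unique.Propositional.Properties using () renaming (filter⁺ to unique-filter⁺)
open import Data.Fin using (Fin; toℕ)
open import Data.Product using (_×_; _,_; proj₁; proj₂; Σ)
open import Data.Sum using (_⊎_; inj₁; inj₂)
open import Data.Empty using (⊥-elim)
open import Data.Unit using (tt)
open import Relation.Binary.PropositionalEquality
import Data.Integer as ℤ
open import Data.Integer.Properties using (pos-*)
import Data.Rational.Unnormalised
open Data.Rational.Unnormalised using (*≤*)
open import Relation.Nullary using (¬_; yes; no)
open import Relation.Binary.Definitions using (tri<; tri≈; tri>)
open import Function using (_∘_)

T⇒≡true : ∀ {b} → T b → b ≡ true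
T⇒≡true {true} _ = refl

≡true⇒T : ∀ {b} → b ≡ true → T b
≡true⇒T refl = tt

¬T⇒≡false : ∀ {b} → ¬ T b → b ≡ false
¬T⇒≡false {false} _   = refl
¬T⇒≡false {true}  ¬T = ⊥-elim (¬T tt)

≤ᵇ-true : ∀ {m n} → m ≤ n → (m ≤ᵇ n) ≡ true
≤ᵇ-true m≤n = T⇒≡true (≤⇒≤ᵇ m≤n)

≤ᵇ-false : ∀ {m n} → n < m → (m ≤ᵇ n) ≡ false
≤ᵇ-false {m} {n} n<m = ¬T⇒≡false (λ t → <⇒≱ n<m (≤ᵇ⇒≤ m n t))

≤ᵇ-true⁻ : ∀ {m n} → (m ≤ᵇ n) ≡ true → m ≤ n
≤ᵇ-true⁻ {m} {n} e = ≤ᵇ⇒≤ m n (≡true⇒T e)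

≤ᵇ-false⁻ : ∀ {m n} → (m ≤ᵇ n) ≡ false → n < m
≤ᵇ-false⁻ e = ≰⇒> (λ m≤n → subst T e (≤⇒≤ᵇ m≤n))

<ᵇ-true : ∀ {m n} → m < n → (m <ᵇ n) ≡ true
<ᵇ-true m<n = T⇒≡true (<⇒<ᵇ m<n)

<ᵇ-false : ∀ {m n} → n ≤ m → (m <ᵇ n) ≡ false
<ᵇ-false {m} {n} n≤m = ¬T⇒≡false (λ t → ≤⇒≯ n≤m (<ᵇ⇒< m n t))

<ᵇ-true⁻ : ∀ {m n} → (m <ᵇ n) ≡ true → m < n
<ᵇ-true⁻ {m} {n} e = <ᵇ⇒< m n (≡true⇒T e)

≡ᵇ-refl : ∀ m → (m ≡ᵇ m) ≡ true
≡ᵇ-refl m = T⇒≡true (≡⇒≡ᵇ m m refl)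

≡ᵇ-false : ∀ {m n} → m ≢ n → (m ≡ᵇ n) ≡ false
≡ᵇ-false {m} {n} m≢n = ¬T⇒≡false (λ t → m≢n (≡ᵇ⇒≡ m n t))

≡ᵇ-true⁻ : ∀ {m n} → (m ≡ᵇ n) ≡ true → m ≡ n
≡ᵇ-true⁻ {m} {n} e = ≡ᵇ⇒≡ m n (≡true⇒T e)

𝟙 : Bool → ℕ
𝟙 b = if b then 1 else 0

countL : {A : Set} → (A → Bool) → List A → ℕ
countL g xs = length (filter (λ x → T? (g x)) xs)

countL-∷ : {A : Set} (g : A → Bool) → ∀ x xs → countL g (x ∷ xs) ≡ 𝟙 (g x) + countL g xs
countL-∷ g x xs with g x
... | true  = refl
... | false = refl

countL-++ : {A : Set} (g : A → Bool) → ∀ xs ys → countL g (xs ++ ys) ≡ countL g xs + countL g ys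
countL-++ g xs ys =
  trans (cong length (filter-++ (λ x → T? (g x)) xs ys)) (length-++ (filter (λ x → T? (g x)) xs))

countL-map : {A B : Set} (g : B → Bool) (h : A → B) → ∀ xs → countL g (map h xs) ≡ countL (λ x → g (h x)) xs
countL-map g h []       = refl
countL-map g h (x ∷ xs) = begin
  countL g (h x ∷ map h xs)                   ≡⟨ countL-∷ g (h x) (map h xs) ⟩
  𝟙 (g (h x)) + countL g (map h xs)           ≡⟨ cong (𝟙 (g (h x)) +_) (countL-map g h xs) ⟩
  𝟙 (g (h x)) + countL (λ x → g (h x)) xs     ≡⟨ countL-∷ (λ x → g (h x)) x xs ⟨
  countL (λ x → g (h x)) (x ∷ xs)             ∎
  where open ≡-Reasoning

countL-cong : {A : Set} {g h : A → Bool} → ∀ xs → (∀ x → g x ≡ h x) → countL g xs ≡ countL h xs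
countL-cong []       g≗h = refl
countL-cong {g = g} {h} (x ∷ xs) g≗h = begin
  countL g (x ∷ xs)        ≡⟨ countL-∷ g x xs ⟩
  𝟙 (g x) + countL g xs    ≡⟨ cong₂ _+_ (cong 𝟙 (g≗h x)) (countL-cong xs g≗h) ⟩
  𝟙 (h x) + countL h xs    ≡⟨ countL-∷ h x xs ⟨
  countL h (x ∷ xs)        ∎
  where open ≡-Reasoning

countL-true : {A : Set} (xs : List A) → countL (λ _ → true) xs ≡ length xs
countL-true []       = refl
countL-true (x ∷ xs) = cong suc (countL-true xs)

countL-false : {A : Set} (xs : List A) → countL (λ _ → false) xs ≡ 0
countL-false []       = refl
countL-false (x ∷ xs) = countL-false xs

countL-product : {C R : Set} (F : List R) (A : C × R → Bool) (B : C → Bool) (k : ℕ) (L : List C) →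
  (∀ c → countL (λ r → A (c , r)) F ≡ (if B c then k else 0)) →
  countL A (concatMap (λ c → map (c ,_) F) L) ≡ countL B L * k
countL-product F A B k []      fibre = refl
countL-product F A B k (c ∷ L) fibre = begin
  countL A (map (c ,_) F ++ rest)                  ≡⟨ countL-++ A (map (c ,_) F) rest ⟩
  countL A (map (c ,_) F) + countL A rest          ≡⟨ cong₂ _+_ (trans (countL-map A (c ,_) F) (fibre c))
                                                                 (countL-product F A B k L fibre) ⟩
  (if B c then k else 0) + countL B L * k          ≡⟨ if-indicator (B c) ⟩
  (𝟙 (B c) + countL B L) * k                       ≡⟨ cong (_* k) (countL-∷ B c L) ⟨
  countL B (c ∷ L) * k                             ∎
  where
  open ≡-Reasoning
  rest = concatMap (λ c → map (c ,_) F) L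
  if-indicator : ∀ b → (if b then k else 0) + countL B L * k ≡ (𝟙 b + countL B L) * k
  if-indicator true  = refl
  if-indicator false = refl

countN : (ℕ → Bool) → ℕ → ℕ
countN p zero    = 0
countN p (suc N) = 𝟙 (p 0) + countN (λ i → p (suc i)) N

countL-tabulate : {A : Set} (g : A → Bool) (p : ℕ → Bool) → ∀ N (f : Fin N → A) →
  (∀ i → g (f i) ≡ p (toℕ i)) → countL g (tabulate f) ≡ countN p N
countL-tabulate g p zero    f g∘f≗p = refl
countL-tabulate g p (suc N) f g∘f≗p = begin
  countL g (f Fin.zero ∷ tabulate (λ i → f (Fin.suc i)))        ≡⟨ countL-∷ g (f Fin.zero) _ ⟩
  𝟙 (g (f Fin.zero)) + countL g (tabulate (λ i → f (Fin.suc i)))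
    ≡⟨ cong₂ _+_ (cong 𝟙 (g∘f≗p Fin.zero))
                 (countL-tabulate g (λ i → p (suc i)) N _ (λ i → g∘f≗p (Fin.suc i))) ⟩
  𝟙 (p 0) + countN (λ i → p (suc i)) N                          ∎
  where open ≡-Reasoning

countL-allFin : ∀ N (p : ℕ → Bool) → countL (λ r → p (toℕ r)) (allFin N) ≡ countN p N
countL-allFin N p = countL-tabulate (λ r → p (toℕ r)) p N (λ i → i) (λ i → refl)

countN-snoc : ∀ N (p : ℕ → Bool) → countN p (suc N) ≡ countN p N + 𝟙 (p N)
countN-snoc zero    p = +-comm (𝟙 (p 0)) 0
countN-snoc (suc N) p =
  trans (cong (𝟙 (p 0) +_) (countN-snoc N (λ i → p (suc i)))) (sym (+-assoc (𝟙 (p 0)) _ _))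

countN-cong : ∀ N {p q : ℕ → Bool} → (∀ i → i < N → p i ≡ q i) → countN p N ≡ countN q N
countN-cong zero    p≗q = refl
countN-cong (suc N) p≗q =
  cong₂ _+_ (cong 𝟙 (p≗q 0 (s≤s z≤n))) (countN-cong N (λ i i<N → p≗q (suc i) (s≤s i<N)))

countN-none : ∀ N (p : ℕ → Bool) → (∀ i → i < N → p i ≡ false) → countN p N ≡ 0
countN-none zero    p none = refl
countN-none (suc N) p none rewrite none 0 (s≤s z≤n) =
  countN-none N (λ i → p (suc i)) (λ i i<N → none (suc i) (s≤s i<N))

countN-complement : ∀ N (p : ℕ → Bool) → countN (λ i → not (p i)) N + countN p N ≡ N
countN-complement zero    p = refl
countN-complement (suc N) p with p 0
... | true  = trans (+-suc _ _) (cong suc (countN-complement N (λ i → p (suc i))))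
... | false = cong suc (countN-complement N (λ i → p (suc i)))

countN-not : ∀ N (p : ℕ → Bool) → countN (λ i → not (p i)) N ≡ N ∸ countN p N
countN-not N p = begin
  countN (λ i → not (p i)) N                       ≡⟨ m+n∸n≡m _ (countN p N) ⟨
  countN (λ i → not (p i)) N + countN p N ∸ countN p N ≡⟨ cong (_∸ countN p N) (countN-complement N p) ⟩
  N ∸ countN p N                                   ∎
  where open ≡-Reasoning

countN-∨ : ∀ N (p q : ℕ → Bool) → (∀ i → p i ∧ q i ≡ false) → countN (λ i → p i ∨ q i) N ≡ countN p N + countN q N
countN-∨ zero    p q disjoint = refl
countN-∨ (suc N) p q disjoint with p 0 | q 0 | disjoint 0
... | true  | false | _ = cong suc (countN-∨ N _ _ (λ i → disjoint (suc i)))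
... | false | true  | _ = trans (cong suc (countN-∨ N _ _ (λ i → disjoint (suc i)))) (sym (+-suc _ _))
... | false | false | _ = countN-∨ N _ _ (λ i → disjoint (suc i))

countN-unique : ∀ N (p : ℕ → Bool) j → j < N → p j ≡ true → (∀ i → p i ≡ true → i ≡ j) → countN p N ≡ 1
countN-unique (suc N) p j j<1+N pj only with j ≟ N
... | yes refl = begin
  countN p (suc N)        ≡⟨ countN-snoc N p ⟩
  countN p N + 𝟙 (p N)    ≡⟨ cong₂ _+_ (countN-none N p others) (cong 𝟙 pj) ⟩
  1                       ∎
  where
  open ≡-Reasoning
  others : ∀ i → i < N → p i ≡ false
  others i i<N with p i in pi
  ... | false = refl
  ... | true  = ⊥-elim (<-irrefl (only i pi) i<N)
... | no j≢N = begin
  countN p (suc N)        ≡⟨ countN-snoc N p ⟩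
  countN p N + 𝟙 (p N)    ≡⟨ cong₂ _+_ (countN-unique N p j (≤∧≢⇒< (≤-pred j<1+N) j≢N) pj only) (cong 𝟙 pN) ⟩
  1                       ∎
  where
  open ≡-Reasoning
  pN : p N ≡ false
  pN with p N in pn
  ... | false = refl
  ... | true  = ⊥-elim (j≢N (sym (only N pn)))

countN-below : ∀ M N (q : ℕ → Bool) → M ≤ N → countN (λ i → (i <ᵇ M) ∧ q i) N ≡ countN q M
countN-below M zero    q z≤n     = refl
countN-below M (suc N) q M≤1+N with m≤n⇒m<n∨m≡n M≤1+N
... | inj₂ refl = countN-cong M (λ i i<M → cong (_∧ q i) (<ᵇ-true i<M))
... | inj₁ M<1+N = begin
  countN (λ i → (i <ᵇ M) ∧ q i) (suc N)                     ≡⟨ countN-snoc N _ ⟩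
  countN (λ i → (i <ᵇ M) ∧ q i) N + 𝟙 ((N <ᵇ M) ∧ q N)      ≡⟨ cong (λ b → countN (λ i → (i <ᵇ M) ∧ q i) N + 𝟙 (b ∧ q N)) (<ᵇ-false (≤-pred M<1+N)) ⟩
  countN (λ i → (i <ᵇ M) ∧ q i) N + 0                       ≡⟨ +-identityʳ _ ⟩
  countN (λ i → (i <ᵇ M) ∧ q i) N                           ≡⟨ countN-below M N q (≤-pred M<1+N) ⟩
  countN q M                                                ∎
  where open ≡-Reasoning

stored : ℕ → Slots → ℕ → Bool
stored M σ x = any (λ j → eqMaybe (σ j) x) (upTo M)

allStored : ℕ → List ℕ → Slots → Bool
allStored M []      σ = true
allStored M (x ∷ Z) σ = stored M σ x ∧ allStored M Z σ

eqMaybe-refl : ∀ x → eqMaybe (just x) x ≡ true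
eqMaybe-refl = ≡ᵇ-refl

eqMaybe-true⁻ : ∀ m x → eqMaybe m x ≡ true → m ≡ just x
eqMaybe-true⁻ (just y) x e = cong just (≡ᵇ-true⁻ e)

stored-intro : ∀ {M} σ {x} j → j < M → σ j ≡ just x → stored M σ x ≡ true
stored-intro {M} σ {x} j j<M σj≡x =
  T⇒≡true (any⁺ _ (lose (∈-upTo⁺ j<M) (≡true⇒T (trans (cong (λ m → eqMaybe m x) σj≡x) (eqMaybe-refl x)))))

stored-elim : ∀ {M σ x} → stored M σ x ≡ true → Σ ℕ λ j → j < M × σ j ≡ just x
stored-elim {M} {σ} {x} e with find (any⁻ (λ j → eqMaybe (σ j) x) (upTo M) (≡true⇒T e))
... | j , j∈upTo , hit = j , ∈-upTo⁻ j∈upTo , eqMaybe-true⁻ (σ j) x (T⇒≡true hit)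

stored-absent : ∀ {M σ x} → (∀ j → j < M → σ j ≢ just x) → stored M σ x ≡ false
stored-absent {M} {σ} {x} nowhere with stored M σ x in e
... | false = refl
... | true with stored-elim {M} e
...   | j , j<M , σj≡x = ⊥-elim (nowhere j j<M σj≡x)

stored-cong : ∀ {M} σ τ x → (∀ j → j < M → eqMaybe (σ j) x ≡ eqMaybe (τ j) x) → stored M σ x ≡ stored M τ x
stored-cong {M} σ τ x agree =
  cong or (map-cong-local (applyUpTo⁺₁ {P = λ j → eqMaybe (σ j) x ≡ eqMaybe (τ j) x} (λ i → i) M (agree _)))

allStored-++ : ∀ M Y Z σ → allStored M (Y ++ Z) σ ≡ allStored M Y σ ∧ allStored M Z σ
allStored-++ M []      Z σ = refl
allStored-++ M (y ∷ Y) Z σ =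
  trans (cong (stored M σ y ∧_) (allStored-++ M Y Z σ)) (sym (∧-assoc (stored M σ y) _ _))

record WellFormed (M n : ℕ) (σ : Slots) : Set where
  field
    bounded   : ∀ j v → j < M → σ j ≡ just v → v ≤ n
    injective : ∀ i j v → i < M → j < M → σ i ≡ just v → σ j ≡ just v → i ≡ j
    emptyTail : ∀ j → n ≤ j → j < M → σ j ≡ nothing
open WellFormed

setSlot-same : ∀ i t σ → setSlot i t σ i ≡ just t
setSlot-same i t σ rewrite ≡ᵇ-refl i = refl

setSlot-other : ∀ i t σ j → j ≢ i → setSlot i t σ j ≡ σ j
setSlot-other i t σ j j≢i rewrite ≡ᵇ-false j≢i = refl

setSlot-cases : ∀ i t σ j {v} → setSlot i t σ j ≡ just v → (j ≡ i × t ≡ v) ⊎ (j ≢ i × σ j ≡ just v)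
setSlot-cases i t σ j e with j ≟ i
... | yes refl = inj₁ (refl , just-injective (trans (sym (setSlot-same i t σ)) e))
... | no j≢i   = inj₂ (j≢i , trans (sym (setSlot-other i t σ j j≢i)) e)

wf-empty : ∀ M → WellFormed M 0 (λ _ → nothing)
wf-empty M = record { bounded = λ _ _ _ () ; injective = λ _ _ _ _ _ () ; emptyTail = λ _ _ _ → refl }

-- step n+1 writes e_{n+1} into a slot i ≤ n (the next empty one, or an evicted one)
wf-write : ∀ {M n σ} i → WellFormed M n σ → i < M → i ≤ n → WellFormed M (suc n) (setSlot i (suc n) σ)
wf-write {M} {n} {σ} i W i<M i≤n = record { bounded = bounded′ ; injective = injective′ ; emptyTail = emptyTail′ }
  where
  σ′ = setSlot i (suc n) σ
  bounded′ : ∀ j v → j < M → σ′ j ≡ just v → v ≤ suc n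
  bounded′ j v j<M e with setSlot-cases i (suc n) σ j e
  ... | inj₁ (_ , refl)  = ≤-refl
  ... | inj₂ (_ , σj≡v)  = m≤n⇒m≤1+n (bounded W j v j<M σj≡v)
  injective′ : ∀ j₁ j₂ v → j₁ < M → j₂ < M → σ′ j₁ ≡ just v → σ′ j₂ ≡ just v → j₁ ≡ j₂
  injective′ j₁ j₂ v j₁<M j₂<M e₁ e₂ with setSlot-cases i (suc n) σ j₁ e₁ | setSlot-cases i (suc n) σ j₂ e₂
  ... | inj₁ (refl , _)    | inj₁ (refl , _)    = refl
  ... | inj₁ (_ , refl)    | inj₂ (_ , σj₂≡v)   = ⊥-elim (1+n≰n (bounded W j₂ _ j₂<M σj₂≡v))
  ... | inj₂ (_ , σj₁≡v)   | inj₁ (_ , refl)    = ⊥-elim (1+n≰n (bounded W j₁ _ j₁<M σj₁≡v))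
  ... | inj₂ (_ , σj₁≡v)   | inj₂ (_ , σj₂≡v)   = injective W j₁ j₂ v j₁<M j₂<M σj₁≡v σj₂≡v
  emptyTail′ : ∀ j → suc n ≤ j → j < M → σ′ j ≡ nothing
  emptyTail′ j n<j j<M =
    trans (setSlot-other i (suc n) σ j (λ j≡i → <⇒≱ n<j (subst (_≤ n) (sym j≡i) i≤n)))
          (emptyTail W j (<⇒≤ n<j) j<M)

wf-keep : ∀ {M n σ} → WellFormed M n σ → M ≤ n → WellFormed M (suc n) σ
wf-keep W M≤n = record
  { bounded   = λ j v j<M e → m≤n⇒m≤1+n (bounded W j v j<M e)
  ; injective = injective W
  ; emptyTail = λ j n<j j<M → ⊥-elim (<⇒≱ j<M (≤-trans M≤n (<⇒≤ n<j))) }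

wf-step : ∀ {M n σ} r → WellFormed M n σ → WellFormed M (suc n) (step M (suc n) r σ)
wf-step {M} {n} r W with suc n ≤ᵇ M in filling
... | true = wf-write n W (≤ᵇ-true⁻ filling) ≤-refl
... | false with toℕ r <ᵇ M in replaces
...   | true  = wf-write (toℕ r) W (<ᵇ-true⁻ {toℕ r} {M} replaces) (≤-trans (<⇒≤ (<ᵇ-true⁻ {toℕ r} {M} replaces)) (≤-pred (≤ᵇ-false⁻ {suc n} {M} filling)))
...   | false = wf-keep W (≤-pred (≤ᵇ-false⁻ {suc n} {M} filling))

sampleAt-step : ∀ M n t → n < t → ∀ c r → sampleAt M (suc n) (c , r) t ≡ step M (suc n) r (sampleAt M n c t)
sampleAt-step M n t n<t c r rewrite ≤ᵇ-true n<t = refl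

sampleAt-frozen : ∀ M n t → t ≤ n → ∀ c r → sampleAt M (suc n) (c , r) t ≡ sampleAt M n c t
sampleAt-frozen M n t t≤n c r rewrite ≤ᵇ-false {suc n} {t} (s≤s t≤n) = refl

sampleAt-horizon : ∀ M n t t′ → n ≤ t → n ≤ t′ → (c : Choices M n) → sampleAt M n c t ≡ sampleAt M n c t′
sampleAt-horizon M zero    t t′ _   _    c       = refl
sampleAt-horizon M (suc n) t t′ n<t n<t′ (c , r) = begin
  sampleAt M (suc n) (c , r) t            ≡⟨ sampleAt-step M n t n<t c r ⟩
  step M (suc n) r (sampleAt M n c t)     ≡⟨ cong (step M (suc n) r) (sampleAt-horizon M n t t′ (<⇒≤ n<t) (<⇒≤ n<t′) c) ⟩
  step M (suc n) r (sampleAt M n c t′)    ≡⟨ sampleAt-step M n t′ n<t′ c r ⟨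
  sampleAt M (suc n) (c , r) t′           ∎
  where open ≡-Reasoning

wf-sampleAt : ∀ M n t → n ≤ t → (c : Choices M n) → WellFormed M n (sampleAt M n c t)
wf-sampleAt M zero    t _   _       = wf-empty M
wf-sampleAt M (suc n) t n<t (c , r) =
  subst (WellFormed M (suc n)) (sym (sampleAt-step M n t n<t c r)) (wf-step r (wf-sampleAt M n t (<⇒≤ n<t) c))

infixl 6 _↾_
_↾_ : List ℕ → ℕ → List ℕ
Z ↾ n = filter (_≤? n) Z

Arrived : ℕ → List ℕ → Set
Arrived n Z = All (λ x → 1 ≤ x × x ≤ n) Z

_∈ᵇ_ : ℕ → List ℕ → Bool
x ∈ᵇ []      = false
x ∈ᵇ (y ∷ Z) = (y ≡ᵇ x) ∨ (x ∈ᵇ Z)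

∈ᵇ-absent : ∀ {x} Z → All (x ≢_) Z → x ∈ᵇ Z ≡ false
∈ᵇ-absent []      []           = refl
∈ᵇ-absent (y ∷ Z) (x≢y ∷ x∉Z) rewrite ≡ᵇ-false (x≢y ∘ sym) = ∈ᵇ-absent Z x∉Z

arrived-mono : ∀ {m k} → m ≤ k → ∀ {Z} → Arrived m Z → Arrived k Z
arrived-mono m≤k = All.map (λ (1≤x , x≤m) → 1≤x , ≤-trans x≤m m≤k)

↾-arrived : ∀ {m} n {Z} → Arrived m Z → Arrived n (Z ↾ n)
↾-arrived n {Z} arrived = All.zip (all-filter⁺ (_≤? n) (All.map proj₁ arrived) , all-filter (_≤? n) Z)

↾-↾ : ∀ {m k} Z → m ≤ k → Z ↾ k ↾ m ≡ Z ↾ m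
↾-↾ []            m≤k = refl
↾-↾ {m} {k} (x ∷ Z) m≤k with x ≤ᵇ k in x≤?k
... | true with x ≤ᵇ m
...   | true  = cong (x ∷_) (↾-↾ Z m≤k)
...   | false = ↾-↾ Z m≤k
↾-↾ {m} {k} (x ∷ Z) m≤k | false with x ≤ᵇ m in x≤?m
...   | true  = ⊥-elim (<⇒≱ (≤ᵇ-false⁻ {x} {k} x≤?k) (≤-trans (≤ᵇ-true⁻ {x} {m} x≤?m) m≤k))
...   | false = ↾-↾ Z m≤k

↾-unique : ∀ n {Z} → Unique Z → Unique (Z ↾ n)
↾-unique n = unique-filter⁺ (_≤? n)

↾-arrived-all : ∀ n {Z} → Arrived n Z → Z ↾ n ≡ Z
↾-arrived-all n arrived = filter-all (_≤? n) (All.map proj₂ arrived)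

↾-zero : ∀ {k Z} → Arrived k Z → Z ↾ 0 ≡ []
↾-zero arrived = filter-none (_≤? 0) (All.map (λ (1≤x , _) x≤0 → 1+n≰n (≤-trans 1≤x x≤0)) arrived)

length-↾-suc : ∀ {n} Z → Unique Z → length (Z ↾ suc n) ≡ 𝟙 (suc n ∈ᵇ Z) + length (Z ↾ n)
length-↾-suc []                          _ = refl
length-↾-suc {n} (x ∷ Z) (x∉Z ∷ unique) with <-cmp x (suc n)
... | tri< x<1+n x≢1+n _
  rewrite filter-accept (_≤? suc n) {xs = Z} (<⇒≤ x<1+n) | filter-accept (_≤? n) {xs = Z} (≤-pred x<1+n) | ≡ᵇ-false x≢1+n
  = trans (cong suc (length-↾-suc Z unique)) (sym (+-suc _ _))
... | tri≈ _ refl _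
  rewrite filter-accept (_≤? suc n) {xs = Z} (≤-refl {suc n}) | filter-reject (_≤? n) {xs = Z} (1+n≰n {n}) | ≡ᵇ-refl (suc n)
  = cong suc (trans (length-↾-suc Z unique) (cong (λ b → 𝟙 b + length (Z ↾ n)) (∈ᵇ-absent Z x∉Z)))
... | tri> _ x≢1+n 1+n<x
  rewrite filter-reject (_≤? suc n) {xs = Z} (<⇒≱ 1+n<x) | filter-reject (_≤? n) {xs = Z} (<⇒≱ (<-trans (n<1+n n) 1+n<x)) | ≡ᵇ-false x≢1+n
  = length-↾-suc Z unique

length-↾-step : ∀ n Z → Unique Z → length (Z ↾ suc n) ≡ 𝟙 (suc n ∈ᵇ (Z ↾ suc n)) + length (Z ↾ n)
length-↾-step n Z unique = begin
  length (Z ↾ suc n)                                  ≡⟨ cong length (↾-↾ Z ≤-refl) ⟨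
  length (Z ↾ suc n ↾ suc n)                          ≡⟨ length-↾-suc (Z ↾ suc n) (↾-unique (suc n) unique) ⟩
  𝟙 (suc n ∈ᵇ (Z ↾ suc n)) + length (Z ↾ suc n ↾ n)  ≡⟨ cong (λ W → 𝟙 (suc n ∈ᵇ (Z ↾ suc n)) + length W) (↾-↾ Z (n≤1+n n)) ⟩
  𝟙 (suc n ∈ᵇ (Z ↾ suc n)) + length (Z ↾ n)          ∎
  where open ≡-Reasoning

-- One step while the reservoir fills (n+1 ≤ M): e_{n+1} is written into the empty
-- slot n, so older times keep their status and n+1 becomes stored.
filling-stored : ∀ {M n σ x} → WellFormed M n σ → x ≤ n → stored M (setSlot n (suc n) σ) x ≡ stored M σ x
filling-stored {M} {n} {σ} {x} W x≤n = stored-cong (setSlot n (suc n) σ) σ x agree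
  where
  agree : ∀ j → j < M → eqMaybe (setSlot n (suc n) σ j) x ≡ eqMaybe (σ j) x
  agree j j<M with j ≟ n
  ... | yes refl rewrite setSlot-same n (suc n) σ | emptyTail W n ≤-refl j<M = ≡ᵇ-false (λ n+1≡x → 1+n≰n (subst (_≤ n) (sym n+1≡x) x≤n))
  ... | no j≢n   rewrite setSlot-other n (suc n) σ j j≢n = refl

filling-allStored : ∀ {M n σ} Z → WellFormed M n σ → suc n ≤ M → Arrived (suc n) Z →
  allStored M Z (setSlot n (suc n) σ) ≡ allStored M (Z ↾ n) σ
filling-allStored []      W n<M []                       = refl
filling-allStored {M} {n} {σ} (x ∷ Z) W n<M ((_ , x≤1+n) ∷ arrived) with x ≤ᵇ n in x≤?n
... | true  = cong₂ _∧_ (filling-stored W (≤ᵇ-true⁻ x≤?n)) (filling-allStored Z W n<M arrived)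
... | false with ≤-antisym x≤1+n (≤ᵇ-false⁻ x≤?n)
...   | refl rewrite stored-intro {M} (setSlot n (suc n) σ) n n<M (setSlot-same n (suc n) σ) = filling-allStored Z W n<M arrived

replace : ℕ → ℕ → ℕ → Slots → Slots
replace M n i σ = if i <ᵇ M then setSlot i (suc n) σ else σ

evicts : ℕ → Slots → ℕ → ℕ → Bool
evicts M σ i x = (i <ᵇ M) ∧ eqMaybe (σ i) x

replace-new : ∀ {M n σ} i → WellFormed M n σ → stored M (replace M n i σ) (suc n) ≡ (i <ᵇ M)
replace-new {M} {n} {σ} i W with i <ᵇ M in i<?M
... | true  = stored-intro (setSlot i (suc n) σ) i (<ᵇ-true⁻ {i} {M} i<?M) (setSlot-same i (suc n) σ)
... | false = stored-absent (λ j j<M σj≡n+1 → 1+n≰n (bounded W j (suc n) j<M σj≡n+1))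

replace-old : ∀ {M n σ x} i → WellFormed M n σ → x ≤ n → stored M (replace M n i σ) x ≡ stored M σ x ∧ not (evicts M σ i x)
replace-old {M} {n} {σ} {x} i W x≤n with i <ᵇ M in i<?M
... | false = sym (∧-identityʳ _)
... | true with eqMaybe (σ i) x in σi≟x
...   | false = trans (stored-cong (setSlot i (suc n) σ) σ x agree) (sym (∧-identityʳ _))
  where
  agree : ∀ j → j < M → eqMaybe (setSlot i (suc n) σ j) x ≡ eqMaybe (σ j) x
  agree j j<M with j ≟ i
  ... | yes refl rewrite setSlot-same i (suc n) σ | σi≟x = ≡ᵇ-false (λ n+1≡x → 1+n≰n (subst (_≤ n) (sym n+1≡x) x≤n))
  ... | no j≢i   rewrite setSlot-other i (suc n) σ j j≢i = refl
...   | true = trans (stored-absent nowhere) (sym (∧-zeroʳ _))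
  where
  nowhere : ∀ j → j < M → setSlot i (suc n) σ j ≢ just x
  nowhere j j<M e with setSlot-cases i (suc n) σ j e
  ... | inj₁ (_ , n+1≡x)   = 1+n≰n (subst (_≤ n) (sym n+1≡x) x≤n)
  ... | inj₂ (j≢i , σj≡x)  = j≢i (injective W j i x j<M (<ᵇ-true⁻ i<?M) σj≡x (eqMaybe-true⁻ (σ i) x σi≟x))

not-∨ : ∀ a b → not (a ∨ b) ≡ not a ∧ not b
not-∨ true  b = refl
not-∨ false b = refl

replace-allStored-old : ∀ {M n σ} i Z → WellFormed M n σ → Arrived n Z →
  allStored M Z (replace M n i σ) ≡ allStored M Z σ ∧ not (any (evicts M σ i) Z)
replace-allStored-old i []      W []                    = refl
replace-allStored-old {M} {n} {σ} i (x ∷ Z) W ((_ , x≤n) ∷ arrived) = begin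
  stored M (replace M n i σ) x ∧ allStored M Z (replace M n i σ)
    ≡⟨ cong₂ _∧_ (replace-old i W x≤n) (replace-allStored-old i Z W arrived) ⟩
  (stored M σ x ∧ not (evicts M σ i x)) ∧ (allStored M Z σ ∧ not (any (evicts M σ i) Z))
    ≡⟨ ∧-interchange (stored M σ x) _ _ _ ⟩
  (stored M σ x ∧ allStored M Z σ) ∧ (not (evicts M σ i x) ∧ not (any (evicts M σ i) Z))
    ≡⟨ cong (_ ∧_) (not-∨ (evicts M σ i x) _) ⟨
  (stored M σ x ∧ allStored M Z σ) ∧ not (evicts M σ i x ∨ any (evicts M σ i) Z)
    ∎
  where open ≡-Reasoning

replace-allStored : ∀ {M n σ} i Z → WellFormed M n σ → Unique Z → Arrived (suc n) Z →
  allStored M Z (replace M n i σ) ≡ (if suc n ∈ᵇ Z then i <ᵇ M else true) ∧ allStored M (Z ↾ n) (replace M n i σ)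
replace-allStored i []      W []              []                    = refl
replace-allStored {M} {n} {σ} i (x ∷ Z) W (x∉Z ∷ unique) ((_ , x≤1+n) ∷ arrived) with x ≤ᵇ n in x≤?n
... | true rewrite ≡ᵇ-false {x} {suc n} (λ x≡n+1 → 1+n≰n (subst (_≤ n) x≡n+1 (≤ᵇ-true⁻ x≤?n))) =
  trans (cong (stored M (replace M n i σ) x ∧_) (replace-allStored i Z W unique arrived))
        (∧-leftComm (stored M (replace M n i σ) x) (if suc n ∈ᵇ Z then i <ᵇ M else true) (allStored M (Z ↾ n) (replace M n i σ)))
... | false with ≤-antisym x≤1+n (≤ᵇ-false⁻ x≤?n)
...   | refl rewrite ≡ᵇ-refl n =
  cong₂ _∧_ (replace-new i W)
            (trans (replace-allStored i Z W unique arrived)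
                   (cong (λ b → (if b then i <ᵇ M else true) ∧ allStored M (Z ↾ n) (replace M n i σ)) (∈ᵇ-absent Z x∉Z)))

∧-true⁻ : ∀ {a b} → a ∧ b ≡ true → a ≡ true × b ≡ true
∧-true⁻ {true}  {true}  _  = refl , refl
∧-true⁻ {true}  {false} ()
∧-true⁻ {false} {_}     ()

-- a choice evicts at most one time of a list of distinct times: its slot holds one time
evicts-one : ∀ {M σ} i x Z → All (x ≢_) Z → evicts M σ i x ∧ any (evicts M σ i) Z ≡ false
evicts-one {M} {σ} i x Z x∉Z with evicts M σ i x in hit
... | false = refl
... | true  = none Z x∉Z
  where
  σi≡x : σ i ≡ just x
  σi≡x = eqMaybe-true⁻ (σ i) x (proj₂ (∧-true⁻ hit))
  none : ∀ Z → All (x ≢_) Z → any (evicts M σ i) Z ≡ false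
  none []      []           = refl
  none (y ∷ Z) (x≢y ∷ x∉Z) = cong₂ _∨_ evicts-y (none Z x∉Z)
    where
    evicts-y : evicts M σ i y ≡ false
    evicts-y = begin
      (i <ᵇ M) ∧ eqMaybe (σ i) y     ≡⟨ cong (λ m → (i <ᵇ M) ∧ eqMaybe m y) σi≡x ⟩
      (i <ᵇ M) ∧ (x ≡ᵇ y)            ≡⟨ cong ((i <ᵇ M) ∧_) (≡ᵇ-false x≢y) ⟩
      (i <ᵇ M) ∧ false               ≡⟨ ∧-zeroʳ (i <ᵇ M) ⟩
      false                          ∎
      where open ≡-Reasoning

-- In a well-formed state storing the distinct times Z, exactly |Z| of the choices
-- i < N (N ≥ M) evict a time of Z: each of them occupies exactly one slot below M.
evictions : ∀ {M n σ} N Z → M ≤ N → WellFormed M n σ → Unique Z → allStored M Z σ ≡ true →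
  countN (λ i → any (evicts M σ i) Z) N ≡ length Z
evictions N []      M≤N W []              _ = countN-none N _ (λ _ _ → refl)
evictions {M} {n} {σ} N (x ∷ Z) M≤N W (x∉Z ∷ unique) all-in with ∧-true⁻ {stored M σ x} all-in
... | x-in , Z-in = begin
  countN (λ i → evicts M σ i x ∨ any (evicts M σ i) Z) N
    ≡⟨ countN-∨ N _ _ (λ i → evicts-one {M} {σ} i x Z x∉Z) ⟩
  countN (λ i → evicts M σ i x) N + countN (λ i → any (evicts M σ i) Z) N
    ≡⟨ cong₂ _+_ exactly-once (evictions N Z M≤N W unique Z-in) ⟩
  suc (length Z)
    ∎
  where
  open ≡-Reasoning
  slot = stored-elim {M} {σ} x-in
  j = proj₁ slot
  j<M = proj₁ (proj₂ slot)
  σj≡x = proj₂ (proj₂ slot)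
  exactly-once : countN (λ i → evicts M σ i x) N ≡ 1
  exactly-once = countN-unique N _ j (≤-trans j<M M≤N)
    (cong₂ _∧_ (<ᵇ-true j<M) (trans (cong (λ m → eqMaybe m x) σj≡x) (eqMaybe-refl x)))
    (λ i hit → let i<?M , σi≟x = ∧-true⁻ {i <ᵇ M} hit in
               injective W i j x (<ᵇ-true⁻ i<?M) j<M (eqMaybe-true⁻ (σ i) x σi≟x) σj≡x)

-- Number of choices at a replacement step n+1 > M keeping all of Z stored, when the
-- earlier part Z ↾ n is stored: if n+1 ∈ Z the choice must replace one of the M slots,
-- and in any case it must not evict one of the |Z ↾ n| earlier times.
replace-count : ∀ {M n σ} Z → M ≤ n → WellFormed M n σ → Unique Z → Arrived (suc n) Z →
  countN (λ i → allStored M Z (replace M n i σ)) (suc n)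
    ≡ (if allStored M (Z ↾ n) σ then (if suc n ∈ᵇ Z then M else suc n) ∸ length (Z ↾ n) else 0)
replace-count {M} {n} {σ} Z M≤n W unique arrived =
  trans (countN-cong (suc n) (λ i _ → trans (replace-allStored i Z W unique arrived)
                                             (cong ((if suc n ∈ᵇ Z then i <ᵇ M else true) ∧_)
                                                   (replace-allStored-old i (Z ↾ n) W (↾-arrived n arrived)))))
        (by-cases (suc n ∈ᵇ Z) (allStored M (Z ↾ n) σ) refl)
  where
  open ≡-Reasoning
  Z′ = Z ↾ n
  evicting : ℕ → Bool
  evicting i = any (evicts M σ i) Z′
  by-cases : ∀ new A → A ≡ allStored M Z′ σ →
    countN (λ i → (if new then i <ᵇ M else true) ∧ (A ∧ not (evicting i))) (suc n)
      ≡ (if A then (if new then M else suc n) ∸ length Z′ else 0)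
  by-cases new   false _ =
    countN-none (suc n) (λ i → (if new then i <ᵇ M else true) ∧ (false ∧ not (evicting i))) (λ i _ → ∧-zeroʳ _)
  by-cases true  true  Z′-in = begin
    countN (λ i → (i <ᵇ M) ∧ not (evicting i)) (suc n)  ≡⟨ countN-below M (suc n) _ (m≤n⇒m≤1+n M≤n) ⟩
    countN (λ i → not (evicting i)) M                    ≡⟨ countN-not M evicting ⟩
    M ∸ countN evicting M                                ≡⟨ cong (M ∸_) (evictions M Z′ ≤-refl W (↾-unique n unique) (sym Z′-in)) ⟩
    M ∸ length Z′                                        ∎
  by-cases false true  Z′-in = begin
    countN (λ i → not (evicting i)) (suc n)  ≡⟨ countN-not (suc n) evicting ⟩
    suc n ∸ countN evicting (suc n)          ≡⟨ cong (suc n ∸_) (evictions (suc n) Z′ (m≤n⇒m≤1+n M≤n) W (↾-unique n unique) (sym Z′-in)) ⟩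
    suc n ∸ length Z′                        ∎

-- The number of choices at step n+1 that keep every time of Z (all arrived by n+1)
-- stored, provided the earlier part Z ↾ n is stored after step n.
factor : ℕ → ℕ → List ℕ → ℕ
factor M n Z = if suc n ≤ᵇ M then 1 else (if suc n ∈ᵇ Z then M else suc n) ∸ length (Z ↾ n)

step-count : ∀ {M n σ} Z → WellFormed M n σ → Unique Z → Arrived (suc n) Z →
  countL (λ r → allStored M Z (step M (suc n) r σ)) (allFin (choiceSize M (suc n)))
    ≡ (if allStored M (Z ↾ n) σ then factor M n Z else 0)
step-count {M} {n} {σ} Z W unique arrived with suc n ≤ᵇ M in filling
... | true rewrite filling-allStored Z W (≤ᵇ-true⁻ {suc n} {M} filling) arrived with allStored M (Z ↾ n) σ
...   | true  = refl
...   | false = refl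
step-count {M} {n} {σ} Z W unique arrived | false =
  trans (countL-allFin (suc n) (λ i → allStored M Z (replace M n i σ)))
        (replace-count Z (≤-pred (≤ᵇ-false⁻ {suc n} {M} filling)) W unique arrived)

choiceSize-full : ∀ {M n} → M ≤ n → choiceSize M (suc n) ≡ suc n
choiceSize-full M≤n rewrite ≤ᵇ-false (s≤s M≤n) = refl

factor-full : ∀ {M n} Z → M ≤ n → factor M n Z ≡ (if suc n ∈ᵇ Z then M else suc n) ∸ length (Z ↾ n)
factor-full Z M≤n rewrite ≤ᵇ-false (s≤s M≤n) = refl

joint : (M n a t : ℕ) → List ℕ → List ℕ → ℕ
joint M n a t Y Z = count M n (λ ω → allStored M Y (sampleAt M n ω a) ∧ allStored M Z (sampleAt M n ω t))

total : ℕ → ℕ → ℕ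
total M n = count M n (λ _ → true)

joint-step : ∀ M n a t Y Z → a ≤ n → n < t → Unique Z → Arrived (suc n) Z →
  joint M (suc n) a t Y Z ≡ joint M n a t Y (Z ↾ n) * factor M n Z
joint-step M n a t Y Z a≤n n<t unique arrived =
  countL-product (allFin (choiceSize M (suc n))) _
    (λ c → allStored M Y (sampleAt M n c a) ∧ allStored M (Z ↾ n) (sampleAt M n c t)) (factor M n Z) (allChoices M n) fibre
  where
  fibre : ∀ c → countL (λ r → allStored M Y (sampleAt M (suc n) (c , r) a) ∧ allStored M Z (sampleAt M (suc n) (c , r) t))
                       (allFin (choiceSize M (suc n)))
              ≡ (if allStored M Y (sampleAt M n c a) ∧ allStored M (Z ↾ n) (sampleAt M n c t) then factor M n Z else 0)
  fibre c = trans (countL-cong (allFin (choiceSize M (suc n))) (λ r → cong₂ (λ σ τ → allStored M Y σ ∧ allStored M Z τ)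
                                              (sampleAt-frozen M n a a≤n c r) (sampleAt-step M n t n<t c r)))
                  (guarded (allStored M Y (sampleAt M n c a)))
    where
    σ = sampleAt M n c t
    guarded : ∀ P → countL (λ r → P ∧ allStored M Z (step M (suc n) r σ)) (allFin (choiceSize M (suc n)))
                    ≡ (if P ∧ allStored M (Z ↾ n) σ then factor M n Z else 0)
    guarded true  = step-count Z (wf-sampleAt M n t (<⇒≤ n<t) c) unique arrived
    guarded false = countL-false (allFin (choiceSize M (suc n)))

joint-step-↾ : ∀ M n a t Y {m} Z → a ≤ n → n < t → Unique Z → Arrived m Z →
  joint M (suc n) a t Y (Z ↾ suc n) ≡ joint M n a t Y (Z ↾ n) * factor M n (Z ↾ suc n)
joint-step-↾ M n a t Y Z a≤n n<t unique arrived = begin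
  joint M (suc n) a t Y (Z ↾ suc n)                       ≡⟨ joint-step M n a t Y (Z ↾ suc n) a≤n n<t
                                                              (↾-unique (suc n) unique) (↾-arrived (suc n) arrived) ⟩
  joint M n a t Y (Z ↾ suc n ↾ n) * factor M n (Z ↾ suc n) ≡⟨ cong (λ W → joint M n a t Y W * factor M n (Z ↾ suc n)) (↾-↾ Z (n≤1+n n)) ⟩
  joint M n a t Y (Z ↾ n) * factor M n (Z ↾ suc n)        ∎
  where open ≡-Reasoning

joint-idle : ∀ M n a t Y Z → a ≤ n → t ≤ n → joint M (suc n) a t Y Z ≡ joint M n a t Y Z * choiceSize M (suc n)
joint-idle M n a t Y Z a≤n t≤n =
  countL-product (allFin (choiceSize M (suc n))) _
    (λ c → allStored M Y (sampleAt M n c a) ∧ allStored M Z (sampleAt M n c t)) (choiceSize M (suc n)) (allChoices M n) fibre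
  where
  constant : ∀ P → countL (λ _ → P) (allFin (choiceSize M (suc n))) ≡ (if P then choiceSize M (suc n) else 0)
  constant true  = trans (countL-true (allFin (choiceSize M (suc n)))) (length-tabulate (λ r → r))
  constant false = countL-false (allFin (choiceSize M (suc n)))
  fibre : ∀ c → countL (λ r → allStored M Y (sampleAt M (suc n) (c , r) a) ∧ allStored M Z (sampleAt M (suc n) (c , r) t))
                       (allFin (choiceSize M (suc n)))
              ≡ (if allStored M Y (sampleAt M n c a) ∧ allStored M Z (sampleAt M n c t) then choiceSize M (suc n) else 0)
  fibre c = trans (countL-cong (allFin (choiceSize M (suc n))) (λ r → cong₂ (λ σ τ → allStored M Y σ ∧ allStored M Z τ)
                                              (sampleAt-frozen M n a a≤n c r) (sampleAt-frozen M n t t≤n c r)))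
                  (constant (allStored M Y (sampleAt M n c a) ∧ allStored M Z (sampleAt M n c t)))

total-suc : ∀ M n → total M (suc n) ≡ total M n * choiceSize M (suc n)
total-suc M n = joint-idle M n 0 0 [] [] z≤n z≤n

positive-* : ∀ {m n} → 0 < m → 0 < n → 0 < m * n
positive-* {suc m} {suc n} _ _ = s≤s z≤n

total-positive : ∀ M n → 0 < total M n
total-positive M zero    = s≤s z≤n
total-positive M (suc n) = subst (0 <_) (sym (total-suc M n)) (positive-* (total-positive M n) (choices-positive (suc n ≤ᵇ M)))
  where
  choices-positive : ∀ b → 0 < (if b then 1 else suc n)
  choices-positive true  = s≤s z≤n
  choices-positive false = s≤s z≤n

-- Falling factorials (x)_k = x (x-1) ⋯ (x-k+1), the numerators and denominators of
-- the inclusion probabilities of reservoir sampling.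
fall : ℕ → ℕ → ℕ
fall x zero    = 1
fall x (suc k) = x * fall (x ∸ 1) k

fall-snoc : ∀ x k → fall x k * (x ∸ k) ≡ fall x (suc k)
fall-snoc x       zero    = trans (+-identityʳ (x ∸ 0)) (sym (*-identityʳ x))
fall-snoc zero    (suc k) = refl
fall-snoc (suc x) (suc k) = trans (*-assoc (suc x) (fall x k) (x ∸ k)) (cong (suc x *_) (fall-snoc x k))

fall-split : ∀ x j k → fall x (j + k) ≡ fall x j * fall (x ∸ j) k
fall-split x zero    k = sym (+-identityʳ (fall x k))
fall-split x (suc j) k = begin
  x * fall (x ∸ 1) (j + k)                      ≡⟨ cong (x *_) (fall-split (x ∸ 1) j k) ⟩
  x * (fall (x ∸ 1) j * fall (x ∸ 1 ∸ j) k)     ≡⟨ cong (λ y → x * (fall (x ∸ 1) j * fall y k)) (∸-+-assoc x 1 j) ⟩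
  x * (fall (x ∸ 1) j * fall (x ∸ suc j) k)     ≡⟨ *-assoc x (fall (x ∸ 1) j) _ ⟨
  x * fall (x ∸ 1) j * fall (x ∸ suc j) k       ∎
  where open ≡-Reasoning

fall-positive : ∀ {x k} → k ≤ x → 0 < fall x k
fall-positive {x}     {zero}  _         = s≤s z≤n
fall-positive {suc x} {suc k} (s≤s k≤x) = positive-* {suc x} (s≤s z≤n) (fall-positive k≤x)

-- How a ratio  N / T = (M)_k / (n)_k  evolves over a step n+1 > M: the arrival n+1
-- either joins the set (`fall-ratio-new`) or not (`fall-ratio-old`).
fall-ratio-new : ∀ M n k N T → N * fall n k ≡ T * fall M k →
  N * (M ∸ k) * fall (suc n) (suc k) ≡ T * suc n * fall M (suc k)
fall-ratio-new M n k N T ratio = begin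
  N * (M ∸ k) * (suc n * fall n k)      ≡⟨ solve 4 (λ N m s f → N :* m :* (s :* f) := (N :* f) :* m :* s) refl N (M ∸ k) (suc n) (fall n k) ⟩
  N * fall n k * (M ∸ k) * suc n        ≡⟨ cong (λ z → z * (M ∸ k) * suc n) ratio ⟩
  T * fall M k * (M ∸ k) * suc n        ≡⟨ solve 4 (λ T f m s → T :* f :* m :* s := T :* s :* (f :* m)) refl T (fall M k) (M ∸ k) (suc n) ⟩
  T * suc n * (fall M k * (M ∸ k))      ≡⟨ cong (T * suc n *_) (fall-snoc M k) ⟩
  T * suc n * fall M (suc k)            ∎
  where open ≡-Reasoning

fall-ratio-old : ∀ M n k N T → N * fall n k ≡ T * fall M k →
  N * (suc n ∸ k) * fall (suc n) k ≡ T * suc n * fall M k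
fall-ratio-old M n k N T ratio = begin
  N * (suc n ∸ k) * fall (suc n) k      ≡⟨ solve 3 (λ N m f → N :* m :* f := N :* (f :* m)) refl N (suc n ∸ k) (fall (suc n) k) ⟩
  N * (fall (suc n) k * (suc n ∸ k))    ≡⟨ cong (N *_) (fall-snoc (suc n) k) ⟩
  N * (suc n * fall n k)                ≡⟨ solve 3 (λ N s f → N :* (s :* f) := N :* f :* s) refl N (suc n) (fall n k) ⟩
  N * fall n k * suc n                  ≡⟨ cong (_* suc n) ratio ⟩
  T * fall M k * suc n                  ≡⟨ solve 3 (λ T f s → T :* f :* s := T :* s :* f) refl T (fall M k) (suc n) ⟩
  T * suc n * fall M k                  ∎
  where open ≡-Reasoning

inclusion-upto : ∀ M a Z → Unique Z → Arrived a Z → ∀ n → n ≤ a →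
  (n ≤ M → joint M n 0 a [] (Z ↾ n) ≡ total M n) ×
  (M ≤ n → joint M n 0 a [] (Z ↾ n) * fall n (length (Z ↾ n)) ≡ total M n * fall M (length (Z ↾ n)))
inclusion-upto M a Z unique arrived zero    _   rewrite ↾-zero arrived = (λ _ → refl) , (λ _ → refl)
inclusion-upto M a Z unique arrived (suc n) n<a = filling , replacing
  where
  open ≡-Reasoning
  IH = inclusion-upto M a Z unique arrived n (<⇒≤ n<a)
  Z′ = Z ↾ suc n
  k = length (Z ↾ n)
  N = joint M n 0 a [] (Z ↾ n)
  new = suc n ∈ᵇ Z′
  one-step : joint M (suc n) 0 a [] Z′ ≡ N * factor M n Z′
  one-step = joint-step-↾ M n 0 a [] Z z≤n n<a unique arrived
  grow : length Z′ ≡ 𝟙 new + k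
  grow = length-↾-step n Z unique
  filling : suc n ≤ M → joint M (suc n) 0 a [] Z′ ≡ total M (suc n)
  filling n<M rewrite one-step | total-suc M n | ≤ᵇ-true n<M = cong (_* 1) (proj₁ IH (<⇒≤ n<M))
  replacing : M ≤ suc n → joint M (suc n) 0 a [] Z′ * fall (suc n) (length Z′) ≡ total M (suc n) * fall M (length Z′)
  replacing M≤1+n with suc n ≤? M
  ... | yes n<M = trans (cong (_* fall (suc n) (length Z′)) (filling n<M))
                        (cong (λ m → total M (suc n) * fall m (length Z′)) (≤-antisym n<M M≤1+n))
  ... | no n≮M = begin
    joint M (suc n) 0 a [] Z′ * fall (suc n) (length Z′)
      ≡⟨ cong₂ _*_ (trans one-step (cong (N *_) (trans (factor-full Z′ M≤n) (cong (λ W → (if new then M else suc n) ∸ length W) (↾-↾ Z (n≤1+n n))))))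
                   (cong (fall (suc n)) grow) ⟩
    N * ((if new then M else suc n) ∸ k) * fall (suc n) (𝟙 new + k)
      ≡⟨ ratio-step new ⟩
    total M n * suc n * fall M (𝟙 new + k)
      ≡⟨ cong₂ _*_ (sym (trans (total-suc M n) (cong (total M n *_) (choiceSize-full M≤n)))) (cong (fall M) (sym grow)) ⟩
    total M (suc n) * fall M (length Z′)
      ∎
    where
    M≤n = ≤-pred (≰⇒> n≮M)
    ratio-step : ∀ b → N * ((if b then M else suc n) ∸ k) * fall (suc n) (𝟙 b + k) ≡ total M n * suc n * fall M (𝟙 b + k)
    ratio-step true  = fall-ratio-new M n k N (total M n) (proj₂ IH M≤n)
    ratio-step false = fall-ratio-old M n k N (total M n) (proj₂ IH M≤n)

incl : ℕ → ℕ → List ℕ → ℕ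
incl M a Z = joint M a 0 a [] Z

inclusion : ∀ M a Z → Unique Z → Arrived a Z →
  (a ≤ M → incl M a Z ≡ total M a) × (M ≤ a → incl M a Z * fall a (length Z) ≡ total M a * fall M (length Z))
inclusion M a Z unique arrived =
  subst (λ W → (a ≤ M → incl M a W ≡ total M a) × (M ≤ a → incl M a W * fall a (length W) ≡ total M a * fall M (length W)))
        (↾-arrived-all a arrived) (inclusion-upto M a Z unique arrived a ≤-refl)

∸-*-exchange : ∀ m c j → m ≤ c → (m ∸ j) * c ≤ m * (c ∸ j)
∸-*-exchange m c j m≤c = begin
  (m ∸ j) * c       ≡⟨ *-distribʳ-∸ c m j ⟩
  m * c ∸ j * c     ≤⟨ ∸-monoʳ-≤ (m * c) (≤-trans (≤-reflexive (*-comm m j)) (*-monoʳ-≤ j m≤c)) ⟩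
  m * c ∸ m * j     ≡⟨ *-distribˡ-∸ m c j ⟨
  m * (c ∸ j)       ∎
  where open ≤-Reasoning

∸-swap : ∀ x j k → x ∸ j ∸ k ≡ x ∸ k ∸ j
∸-swap x j k = trans (∸-+-assoc x j k) (trans (cong (x ∸_) (+-comm j k)) (sym (∸-+-assoc x k j)))

-- (M − j)_k · (a)_k ≤ (M)_k · (a − j)_k  for M ≤ a: removing j elements lowers the
-- ratio (M)_k / (a)_k, since (M − j − i)/(a − j − i) ≤ (M − i)/(a − i) factor by factor.
fall-exchange : ∀ j k M a → M ≤ a → fall (M ∸ j) k * fall a k ≤ fall M k * fall (a ∸ j) k
fall-exchange j zero    M a M≤a = ≤-refl
fall-exchange j (suc k) M a M≤a = begin
  fall (M ∸ j) (suc k) * fall a (suc k)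
    ≡⟨ cong₂ _*_ (sym (fall-snoc (M ∸ j) k)) (sym (fall-snoc a k)) ⟩
  fall (M ∸ j) k * (M ∸ j ∸ k) * (fall a k * (a ∸ k))
    ≡⟨ solve 4 (λ A p B q → A :* p :* (B :* q) := (A :* B) :* (p :* q)) refl (fall (M ∸ j) k) (M ∸ j ∸ k) (fall a k) (a ∸ k) ⟩
  (fall (M ∸ j) k * fall a k) * ((M ∸ j ∸ k) * (a ∸ k))
    ≤⟨ *-mono-≤ (fall-exchange j k M a M≤a)
                (≤-trans (≤-reflexive (cong (_* (a ∸ k)) (∸-swap M j k))) (∸-*-exchange (M ∸ k) (a ∸ k) j (∸-monoˡ-≤ k M≤a))) ⟩
  (fall M k * fall (a ∸ j) k) * ((M ∸ k) * (a ∸ k ∸ j))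
    ≡⟨ solve 4 (λ A B p q → (A :* B) :* (p :* q) := A :* p :* (B :* q)) refl (fall M k) (fall (a ∸ j) k) (M ∸ k) (a ∸ k ∸ j) ⟩
  fall M k * (M ∸ k) * (fall (a ∸ j) k * (a ∸ k ∸ j))
    ≡⟨ cong₂ _*_ (fall-snoc M k) (trans (cong (fall (a ∸ j) k *_) (∸-swap a k j)) (fall-snoc (a ∸ j) k)) ⟩
  fall M (suc k) * fall (a ∸ j) (suc k)
    ∎
  where open ≤-Reasoning

fall-negcorr : ∀ M a j k W P Q R → j + k ≤ M → M ≤ a →
  P * fall a (j + k) ≡ W * fall M (j + k) → Q * fall a k ≡ W * fall M k → R * fall a j ≡ W * fall M j → P * W ≤ Q * R
fall-negcorr M a j k W P Q R j+k≤M M≤a lawP lawQ lawR = *-cancelʳ-≤ (P * W) (Q * R) c {{>-nonZero c-positive}} (begin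
  P * W * c                                   ≡⟨ solve 5 (λ P W u C D → P :* W :* (u :* C :* D) := P :* (u :* D) :* (W :* C)) refl P W (fall a j) (fall a k) (fall (a ∸ j) k) ⟩
  P * (fall a j * fall (a ∸ j) k) * (W * fall a k)
                                              ≡⟨ cong (λ z → z * (W * fall a k)) lawP′ ⟩
  W * (fall M j * fall (M ∸ j) k) * (W * fall a k)
                                              ≡⟨ solve 4 (λ W v E C → W :* (v :* E) :* (W :* C) := W :* W :* v :* (E :* C)) refl W (fall M j) (fall (M ∸ j) k) (fall a k) ⟩
  W * W * fall M j * (fall (M ∸ j) k * fall a k)
                                              ≤⟨ *-monoʳ-≤ (W * W * fall M j) (fall-exchange j k M a M≤a) ⟩
  W * W * fall M j * (fall M k * fall (a ∸ j) k)
                                              ≡⟨ solve 4 (λ W v E D → W :* W :* v :* (E :* D) := (W :* E) :* (W :* v) :* D) refl W (fall M j) (fall M k) (fall (a ∸ j) k) ⟩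
  W * fall M k * (W * fall M j) * fall (a ∸ j) k
                                              ≡⟨ cong₂ (λ x y → x * y * fall (a ∸ j) k) lawQ lawR ⟨
  Q * fall a k * (R * fall a j) * fall (a ∸ j) k
                                              ≡⟨ solve 5 (λ Q C R u D → Q :* C :* (R :* u) :* D := Q :* R :* (u :* C :* D)) refl Q (fall a k) R (fall a j) (fall (a ∸ j) k) ⟩
  Q * R * c                                   ∎)
  where
  open ≤-Reasoning
  c = fall a j * fall a k * fall (a ∸ j) k
  j+k≤a = ≤-trans j+k≤M M≤a
  c-positive : 0 < c
  c-positive = positive-* (positive-* (fall-positive (≤-trans (m≤m+n j k) j+k≤a)) (fall-positive (≤-trans (m≤n+m k j) j+k≤a)))
                          (fall-positive (subst (_≤ a ∸ j) (m+n∸m≡n j k) (∸-monoˡ-≤ j j+k≤a)))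
  lawP′ : P * (fall a j * fall (a ∸ j) k) ≡ W * (fall M j * fall (M ∸ j) k)
  lawP′ = trans (cong (P *_) (sym (fall-split a j k))) (trans lawP (cong (W *_) (fall-split M j k)))

positive-*⁻ˡ : ∀ m {n} → 0 < m * n → 0 < m
positive-*⁻ˡ (suc m) _ = s≤s z≤n

positive-*⁻ʳ : ∀ m {n} → 0 < m * n → 0 < n
positive-*⁻ʳ m {suc n} _ = s≤s z≤n
positive-*⁻ʳ m {zero}  p rewrite *-zeroʳ m = p

inclusion-negcorr : ∀ M a Y Z → Unique Y → Unique Z → All (λ y → All (y ≢_) Z) Y →
  Arrived a Y → Arrived a Z → length Y + length Z ≤ M →
  incl M a (Y ++ Z) * total M a ≤ incl M a Z * incl M a Y × 0 < incl M a Y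
inclusion-negcorr M a Y Z uniqueY uniqueZ disjoint arrivedY arrivedZ size with a ≤? M
... | yes a≤M =
  ≤-reflexive (trans (cong (_* total M a) (proj₁ lawYZ a≤M)) (sym (cong₂ _*_ (proj₁ lawZ a≤M) (proj₁ lawY a≤M)))) ,
  subst (0 <_) (sym (proj₁ lawY a≤M)) (total-positive M a)
  where
  lawYZ = inclusion M a (Y ++ Z) (unique-++⁺ uniqueY uniqueZ disjoint) (all-++⁺ arrivedY arrivedZ)
  lawY  = inclusion M a Y uniqueY arrivedY
  lawZ  = inclusion M a Z uniqueZ arrivedZ
... | no a≰M =
  fall-negcorr M a (length Y) (length Z) (total M a) (incl M a (Y ++ Z)) (incl M a Z) (incl M a Y) size M≤a
               lawYZ′ (proj₂ lawZ M≤a) (proj₂ lawY M≤a) ,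
  positive-*⁻ˡ (incl M a Y) (subst (0 <_) (sym (proj₂ lawY M≤a))
                                   (positive-* (total-positive M a) (fall-positive (≤-trans (m≤m+n (length Y) (length Z)) size))))
  where
  M≤a = <⇒≤ (≰⇒> a≰M)
  lawYZ = inclusion M a (Y ++ Z) (unique-++⁺ uniqueY uniqueZ disjoint) (all-++⁺ arrivedY arrivedZ)
  lawY  = inclusion M a Y uniqueY arrivedY
  lawZ  = inclusion M a Z uniqueZ arrivedZ
  lawYZ′ : incl M a (Y ++ Z) * fall a (length Y + length Z) ≡ total M a * fall M (length Y + length Z)
  lawYZ′ = subst (λ s → incl M a (Y ++ Z) * fall a s ≡ total M a * fall M s) (length-++ Y) (proj₂ lawYZ M≤a)

-- At time a ≤ t the sample observed at t is still S_a, so the joint count after a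
-- steps is the inclusion count of Y ∪ Z.
joint-at : ∀ M a t Y Z → a ≤ t → joint M a a t Y Z ≡ incl M a (Y ++ Z)
joint-at M a t Y Z a≤t = countL-cong (allChoices M a) (λ ω →
  trans (cong (λ σ → allStored M Y (sampleAt M a ω a) ∧ allStored M Z σ) (sampleAt-horizon M a t a a≤t ≤-refl ω))
        (sym (allStored-++ M Y Z (sampleAt M a ω a))))

later-steps : ∀ M a t Z → Unique Z → Arrived t Z → ∀ n → a ≤ n →
  Σ ℕ λ F → ∀ Y → joint M n a t Y (Z ↾ n) ≡ joint M a a t Y (Z ↾ a) * F
later-steps M a t Z unique arrived zero    z≤n   = 1 , λ Y → sym (*-identityʳ _)
later-steps M a t Z unique arrived (suc n) a≤1+n with m≤n⇒m<n∨m≡n a≤1+n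
... | inj₂ refl = 1 , λ Y → sym (*-identityʳ _)
... | inj₁ a<1+n with later-steps M a t Z unique arrived n (≤-pred a<1+n) | n <? t
...   | F , earlier | yes n<t = F * factor M n (Z ↾ suc n) , λ Y → begin
  joint M (suc n) a t Y (Z ↾ suc n)                       ≡⟨ joint-step-↾ M n a t Y Z (≤-pred a<1+n) n<t unique arrived ⟩
  joint M n a t Y (Z ↾ n) * factor M n (Z ↾ suc n)        ≡⟨ cong (_* factor M n (Z ↾ suc n)) (earlier Y) ⟩
  joint M a a t Y (Z ↾ a) * F * factor M n (Z ↾ suc n)    ≡⟨ *-assoc (joint M a a t Y (Z ↾ a)) F (factor M n (Z ↾ suc n)) ⟩
  joint M a a t Y (Z ↾ a) * (F * factor M n (Z ↾ suc n))  ∎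
  where open ≡-Reasoning
...   | F , earlier | no n≮t = F * choiceSize M (suc n) , λ Y → begin
  joint M (suc n) a t Y (Z ↾ suc n)                       ≡⟨ cong (joint M (suc n) a t Y) (↾-arrived-all (suc n) (arrived-mono (m≤n⇒m≤1+n t≤n) arrived)) ⟩
  joint M (suc n) a t Y Z                                 ≡⟨ joint-idle M n a t Y Z (≤-pred a<1+n) t≤n ⟩
  joint M n a t Y Z * choiceSize M (suc n)                ≡⟨ cong (λ W → joint M n a t Y W * choiceSize M (suc n)) (↾-arrived-all n (arrived-mono t≤n arrived)) ⟨
  joint M n a t Y (Z ↾ n) * choiceSize M (suc n)          ≡⟨ cong (_* choiceSize M (suc n)) (earlier Y) ⟩
  joint M a a t Y (Z ↾ a) * F * choiceSize M (suc n)      ≡⟨ *-assoc (joint M a a t Y (Z ↾ a)) F (choiceSize M (suc n)) ⟩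
  joint M a a t Y (Z ↾ a) * (F * choiceSize M (suc n))    ∎
  where
  open ≡-Reasoning
  t≤n = ≮⇒≥ n≮t

-- Negative correlation of  Y ⊆ S_a  and  X ⊆ S_b  for a ≤ b ≤ n and disjoint sets of
-- distinct times with |Y| + |X| ≤ M:  #(both) · |Ω_n| ≤ #(X ⊆ S_b) · #(Y ⊆ S_a),  and
-- #(Y ⊆ S_a) > 0.  By `later-steps` all four counts are the corresponding counts at
-- time a times factors independent of Y, so this reduces to `inclusion-negcorr`.
negative-correlation : ∀ M a b n Y X → a ≤ b → b ≤ n → Unique Y → Unique X → All (λ y → All (y ≢_) X) Y →
  Arrived a Y → Arrived b X → length Y + length X ≤ M →
  joint M n a b Y X * total M n ≤ joint M n a b [] X * joint M n a b Y [] × 0 < joint M n a b Y []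
negative-correlation M a b n Y X a≤b b≤n uniqueY uniqueX disjoint arrivedY arrivedX size =
  inequality , subst (0 <_) (sym countY) (positive-* (proj₂ atA) G-positive)
  where
  X′ = X ↾ a
  lateX = later-steps M a b X uniqueX arrivedX n (≤-trans a≤b b≤n)
  late∅ = later-steps M a b [] [] [] n (≤-trans a≤b b≤n)
  F = proj₁ lateX
  G = proj₁ late∅
  atA = inclusion-negcorr M a Y X′ uniqueY (↾-unique a uniqueX) (All.map (all-filter⁺ (_≤? a)) disjoint) arrivedY (↾-arrived a arrivedX)
                          (≤-trans (+-monoʳ-≤ (length Y) (length-filter (_≤? a) X)) size)
  countX : ∀ Y → joint M n a b Y X ≡ incl M a (Y ++ X′) * F
  countX Y = trans (cong (joint M n a b Y) (sym (↾-arrived-all n (arrived-mono b≤n arrivedX))))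
                   (trans (proj₂ lateX Y) (cong (_* F) (joint-at M a b Y X′ a≤b)))
  countY : joint M n a b Y [] ≡ incl M a Y * G
  countY = trans (proj₂ late∅ Y) (cong (_* G) (trans (joint-at M a b Y [] a≤b) (cong (incl M a) (++-identityʳ Y))))
  count∅ : total M n ≡ total M a * G
  count∅ = proj₂ late∅ []
  G-positive : 0 < G
  G-positive = positive-*⁻ʳ (total M a) (subst (0 <_) count∅ (total-positive M n))
  inequality : joint M n a b Y X * total M n ≤ joint M n a b [] X * joint M n a b Y []
  inequality = begin
    joint M n a b Y X * total M n                ≡⟨ cong₂ _*_ (countX Y) count∅ ⟩
    incl M a (Y ++ X′) * F * (total M a * G)     ≡⟨ solve 4 (λ P F W G → P :* F :* (W :* G) := P :* W :* (F :* G)) refl (incl M a (Y ++ X′)) F (total M a) G ⟩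
    incl M a (Y ++ X′) * total M a * (F * G)     ≤⟨ *-monoˡ-≤ (F * G) (proj₁ atA) ⟩
    incl M a X′ * incl M a Y * (F * G)           ≡⟨ solve 4 (λ Q R F G → Q :* R :* (F :* G) := Q :* F :* (R :* G)) refl (incl M a X′) (incl M a Y) F G ⟩
    incl M a X′ * F * (incl M a Y * G)           ≡⟨ cong₂ _*_ (countX []) countY ⟨
    joint M n a b [] X * joint M n a b Y []      ∎
    where open ≤-Reasoning

conditional-≤ : ∀ M n (A B : Choices M n → Bool) →
  count M n (λ ω → A ω ∧ B ω) * total M n ≤ count M n A * count M n B → 0 < count M n B →
  PrCond M n A B Data.Rational.Unnormalised.≤ Pr M n A
conditional-≤ M n A B counts B-positive with count M n B
... | zero  = ⊥-elim (<-irrefl refl B-positive)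
... | suc k = *≤* (subst₂ ℤ._≤_ (pos-* #AB (suc (pred L))) (pos-* #A (suc k)) (ℤ.+≤+ cleared))
  where
  #AB = count M n (λ ω → A ω ∧ B ω)
  #A  = count M n A
  L   = length (allChoices M n)
  total≡L : total M n ≡ L
  total≡L = countL-true (allChoices M n)
  cleared : #AB * suc (pred L) ≤ #A * suc k
  cleared = subst (λ m → #AB * m ≤ #A * suc k)
                  (trans total≡L (sym (suc-pred L {{>-nonZero (subst (0 <_) total≡L (total-positive M n))}})))
                  counts

earlierEdges : {e : Stream} → Triangle e → List ℕ
earlierEdges τ = t₁ τ ∷ t₂ τ ∷ []

<⇒≤∸1 : ∀ {m n} → m < n → m ≤ n ∸ 1
<⇒≤∸1 (s≤s m≤n) = m≤n

earlierEdges-unique : {e : Stream} (τ : Triangle e) → Unique (earlierEdges τ)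
earlierEdges-unique τ = ((<⇒≢ (t₁<t₂ τ)) ∷ []) ∷ ([] ∷ [])

earlierEdges-arrived : {e : Stream} (τ : Triangle e) → Arrived (t₃ τ ∸ 1) (earlierEdges τ)
earlierEdges-arrived τ =
  (1≤t₁ τ , <⇒≤∸1 (<-trans (t₁<t₂ τ) (t₂<t₃ τ))) ∷ (≤-trans (1≤t₁ τ) (<⇒≤ (t₁<t₂ τ)) , <⇒≤∸1 (t₂<t₃ τ)) ∷ []

D-allStored : ∀ M n {e : Stream} (τ : Triangle e) ω → D M n τ ω ≡ allStored M (earlierEdges τ) (sampleAt M n ω (t₃ τ ∸ 1))
D-allStored M n τ ω = cong (stored M (sampleAt M n ω (t₃ τ ∸ 1)) (t₁ τ) ∧_) (sym (∧-identityʳ _))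

lemma4p14 : (M : ℕ) → 6 Data.Nat.≤ M → (e : Stream) → ValidStream e → (λ' γ : Triangle e) → EdgeDisjoint λ' γ → t₃ λ' < t₃ γ → (n : ℕ) → t₃ γ Data.Nat.≤ n → PrCond M n (D M n γ) (D M n λ') Data.Rational.Unnormalised.≤ Pr M n (D M n γ)
lemma4p14 M 6≤M e _ λ' γ (λ₁≢γ₁ , λ₁≢γ₂ , _ , λ₂≢γ₁ , λ₂≢γ₂ , _) t₃λ<t₃γ n t₃γ≤n =
  conditional-≤ M n (D M n γ) (D M n λ')
    (subst₂ _≤_ (cong (_* total M n) (sym both)) (sym (cong₂ _*_ onlyγ onlyλ)) (proj₁ correlation))
    (subst (0 <_) (sym onlyλ) (proj₂ correlation))
  where
  a = t₃ λ' ∸ 1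
  b = t₃ γ ∸ 1
  Y = earlierEdges λ'
  X = earlierEdges γ
  correlation = negative-correlation M a b n Y X (∸-monoˡ-≤ 1 (<⇒≤ t₃λ<t₃γ)) (≤-trans (m∸n≤m (t₃ γ) 1) t₃γ≤n)
    (earlierEdges-unique λ') (earlierEdges-unique γ) ((λ₁≢γ₁ ∷ λ₁≢γ₂ ∷ []) ∷ (λ₂≢γ₁ ∷ λ₂≢γ₂ ∷ []) ∷ [])
    (earlierEdges-arrived λ') (earlierEdges-arrived γ) (≤-trans (s≤s (s≤s (s≤s (s≤s z≤n)))) 6≤M)
  both : count M n (λ ω → D M n γ ω ∧ D M n λ' ω) ≡ joint M n a b Y X
  both = countL-cong (allChoices M n) (λ ω → trans (cong₂ _∧_ (D-allStored M n γ ω) (D-allStored M n λ' ω))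
                                                    (∧-comm (allStored M X (sampleAt M n ω b)) (allStored M Y (sampleAt M n ω a))))
  onlyγ : count M n (D M n γ) ≡ joint M n a b [] X
  onlyγ = countL-cong (allChoices M n) (D-allStored M n γ)
  onlyλ : count M n (D M n λ') ≡ joint M n a b Y []
  onlyλ = countL-cong (allChoices M n) (λ ω → trans (D-allStored M n λ' ω) (sym (∧-identityʳ _)))
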